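{- Let $q\equiv1\pmod4$ be a prime with $p=2q+1$ prime, let $\zeta=\exp(2\pi i/(p-1))$, let $\chi$ be the Dirichlet character modulo $p$ with $\chi(2)=\zeta$, and write $f_\chi(x)=\sum_{i=0}^{2p-4}b_ix^i$ for the polynomial defined below. Then all coefficients $b_i$ are non-negative integers, and $$b_0=p-1,\qquad b_1=\frac{p-1}{2}+1,\qquad b_p=b_{p-1}=0.$$
   Context: Here $2$ is a primitive root modulo $p$, so $\chi$ is well defined. For a Dirichlet character $\xi$ modulo $p$ and an integer $d$ with $p\nmid d$, let $t(\xi,d)$ be the integer with $0\le t(\xi,d)\le p-2$ and $\xi(d)=\zeta^{t(\xi,d)}$. For $1\le j\le p-1$ let $h_{\xi,j}(x)=\sum_{0<d\mid j}x^{t(\xi,d)}$, and let $f_\xi(x)=\sum_{j=1}^{p-1}h_{\xi,j}(x)\,h_{\overline\xi,p-j}(x)$ (a polynomial of degree at most $2p-4$), where $\overline\xi$ is the complex conjugate character. -}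

module Defs where

open import Data.Nat using (ℕ; zero; suc; _+_; _*_; _∸_; _^_; _≡ᵇ_)
open import Data.Nat.DivMod using (_%_)
open import Data.Nat.Divisibility using (_∣?_)
open import Data.Bool using (Bool; true; false; if_then_else_)
open import Data.Integer as ℤ using (ℤ; 0ℤ; 1ℤ)
open import Relation.Nullary.Decidable using (does)

modN : ℕ → ℕ → ℕ
modN a zero    = a
modN a (suc n) = a % suc n

-- Discrete logarithm to base 2 modulo p:
-- the least k with 0 ≤ k ≤ p-2 and 2^k ≡ d (mod p)  (0 if none exists).
-- When 2 is a primitive root mod p and p ∤ d, this is t(χ,d), where
-- χ is the character mod p with χ(2) = ζ = exp(2πi/(p-1)),
-- since χ(2^k) = ζ^k.
dlogFrom : (p d k fuel : ℕ) → ℕ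
dlogFrom p d k zero = 0
dlogFrom p d k (suc fuel) =
  if modN (2 ^ k) p ≡ᵇ modN d p then k else dlogFrom p d (suc k) fuel

tχ : (p d : ℕ) → ℕ
tχ p d = dlogFrom p d 0 (p ∸ 1)

-- t(χ̄,d): χ̄(d) = ζ^{-t(χ,d)}, reduced into [0, p-2]
tχbar : (p d : ℕ) → ℕ
tχbar p d with tχ p d
... | zero  = 0
... | suc k = (p ∸ 1) ∸ suc k

Poly : Set
Poly = ℕ → ℤ

sumBelow : ℕ → (ℕ → ℤ) → ℤ
sumBelow zero    f = 0ℤ
sumBelow (suc n) f = sumBelow n f ℤ.+ f n

mono : ℕ → Poly
mono t i = if i ≡ᵇ t then 1ℤ else 0ℤ

_⊕_ : Poly → Poly → Poly
(a ⊕ b) i = a i ℤ.+ b i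

zeroP : Poly
zeroP i = 0ℤ

_⊛_ : Poly → Poly → Poly
(a ⊛ b) i = sumBelow (suc i) (λ k → a k ℤ.* b (i ∸ k))

sumDivs : (j n : ℕ) → (ℕ → Poly) → Poly
sumDivs j zero    g = zeroP
sumDivs j (suc n) g =
  if does (suc n ∣? j) then sumDivs j n g ⊕ g (suc n) else sumDivs j n g

h : (t : ℕ → ℕ) → (j : ℕ) → Poly
h t j = sumDivs j j (λ d → mono (t d))

sumPoly : ℕ → (ℕ → Poly) → Poly
sumPoly zero    P = zeroP
sumPoly (suc n) P = sumPoly n P ⊕ P (suc n)

fχ : (p : ℕ) → Poly
fχ p = sumPoly (p ∸ 1) (λ j → h (tχ p) j ⊛ h (tχbar p) (p ∸ j))

{-# OPTIONS --safe #-}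
-- Since q ≡ 1 (mod 4), p = 2q + 1 ≡ 3 (mod 8) and Gauss's lemma gives 2^q ≡ −1 (mod p);
-- as q is prime the order of 2 is then 2q = p − 1.  So 2 is a primitive root, t(χ,·) is the
-- discrete logarithm to base 2, and t(χ̄,e) = p − 1 − t(χ,e) for e ≠ 1.  The coefficient of x^i
-- in h_{χ,j} h_{χ̄,p−j} counts the pairs d ∣ j, e ∣ p − j with t(χ,d) + t(χ̄,e) = i.  For i = 0
-- only (1,1) qualifies; for i = 1 the pairs are (2,1) for even j and (1,(p+1)/2) for j = q.
-- For i = p − 1 a pair needs d = e ≠ 1, a common divisor of j and p − j; for i = p it needs
-- d ≡ 2e (mod p) with d, e ≠ 1, and then d or e divides p.  Neither is possible.

module Submission where

open import Defs
open import Data.Bool using (true; false; T; if_then_else_)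
open import Data.Fin as Fin using (Fin; toℕ; fromℕ<; punchOut)
import Data.Fin.Properties as Fin
open import Data.Integer as ℤ using (ℤ; +_; 0ℤ; 1ℤ; -1ℤ)
import Data.Integer.Properties as ℤP
import Data.Integer.Tactic.RingSolver as ℤ-Solver
open import Data.Nat
open import Data.Nat.Coprimality using (Coprime; coprime-divisor)
open import Data.Nat.DivMod
open import Data.Nat.Divisibility
open import Data.Nat.Induction using (<-rec)
open import Data.Nat.Primality
  using (Prime; euclidsLemma; prime[2]; prime⇒irreducible; prime⇒nonZero; prime⇒nonTrivial)
open import Data.Nat.Properties
import Data.Nat.Tactic.RingSolver as ℕ-Solver
open import Data.Product using (∃; _×_; _,_; proj₁; proj₂; map₁; map₂; uncurry)
open import Data.Sum using (_⊎_; inj₁; inj₂; [_,_]′)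
open import Function using (_∘_)
open import Function.Definitions using (Injective)
open import Relation.Nullary using (¬_; Dec; yes; no; does; contradiction)
open import Relation.Nullary.Decidable using (dec-true; dec-false)
open import Relation.Binary.PropositionalEquality

∣⇒pos : ∀ {d j} → 0 < j → d ∣ j → 0 < d
∣⇒pos {zero}  0<j 0∣j = contradiction (0∣⇒≡0 0∣j) (>⇒≢ 0<j)
∣⇒pos {suc _} _   _   = z<s

∣∧<⇒≡0 : ∀ {n x} → n ∣ x → x < n → x ≡ 0
∣∧<⇒≡0 {x = zero}  _   _   = refl
∣∧<⇒≡0 {x = suc _} n∣x x<n = contradiction n∣x (>⇒∤ x<n)

%≡%⇒∣∸ : ∀ {a b} n .{{_ : NonZero n}} → a % n ≡ b % n → n ∣ a ∸ b
%≡%⇒∣∸ {a} {b} n a%n≡b%n = divides (a / n ∸ b / n) (begin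
  a ∸ b                                          ≡⟨ cong₂ _∸_ (m≡m%n+[m/n]*n a n) (m≡m%n+[m/n]*n b n) ⟩
  (a % n + a / n * n) ∸ (b % n + b / n * n)      ≡⟨ cong (λ z → z + a / n * n ∸ (b % n + b / n * n)) a%n≡b%n ⟩
  (b % n + a / n * n) ∸ (b % n + b / n * n)      ≡⟨ [m+n]∸[m+o]≡n∸o (b % n) _ _ ⟩
  a / n * n ∸ b / n * n                          ≡⟨ *-distribʳ-∸ n (a / n) (b / n) ⟨
  (a / n ∸ b / n) * n                            ∎)
  where open ≡-Reasoning

∣∧<2*⇒≡ : ∀ {e m} → e ∣ m → 0 < m → m < 2 * e → m ≡ e
∣∧<2*⇒≡ (divides zero       refl) () _
∣∧<2*⇒≡ (divides (suc zero) refl) _  _ = +-identityʳ _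
∣∧<2*⇒≡ {e} (divides (suc (suc c)) refl) _ m<2e =
  contradiction m<2e (≤⇒≯ (*-monoˡ-≤ e {2} {2 + c} (s≤s (s≤s z≤n))))

∣∧∣∸⇒∣ : ∀ {d j m} → j ≤ m → d ∣ j → d ∣ m ∸ j → d ∣ m
∣∧∣∸⇒∣ j≤m d∣j d∣m∸j = subst (_ ∣_) (m+[n∸m]≡n j≤m) (∣m∣n⇒∣m+n d∣j d∣m∸j)

prime∧∣∧<⇒≡1 : ∀ {p d} → Prime p → d ∣ p → d < p → d ≡ 1
prime∧∣∧<⇒≡1 p-prime d∣p d<p with prime⇒irreducible p-prime d∣p
... | inj₁ d≡1 = d≡1
... | inj₂ refl = contradiction d<p (<-irrefl refl)

∤⇒coprime : ∀ {q k} → Prime q → ¬ q ∣ k → Coprime k q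
∤⇒coprime q-prime q∤k (i∣k , i∣q) with prime⇒irreducible q-prime i∣q
... | inj₁ i≡1 = i≡1
... | inj₂ refl = contradiction i∣k q∤k

∣2*q∧∤q⇒≡2 : ∀ {q k} → Prime q → k ∣ 2 * q → ¬ k ∣ q → k < 2 * q → k ≡ 2
∣2*q∧∤q⇒≡2 {q} {k} q-prime k∣2q k∤q k<2q with q ∣? k
... | yes (divides m refl) with prime⇒irreducible prime[2] {m} (*-cancelʳ-∣ q {{prime⇒nonZero q-prime}} k∣2q)
...   | inj₁ refl = contradiction (∣-reflexive (*-identityˡ q)) k∤q
...   | inj₂ refl = contradiction k<2q (<-irrefl refl)
∣2*q∧∤q⇒≡2 {q} {k} q-prime k∣2q k∤q k<2q | no q∤k
  with prime⇒irreducible prime[2] (coprime-divisor (∤⇒coprime q-prime q∤k) (subst (k ∣_) (*-comm 2 q) k∣2q))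
... | inj₁ refl = contradiction (1∣ q) k∤q
... | inj₂ k≡2 = k≡2

[m*m]%[1+m]≡1 : ∀ m → 0 < m → m * m % suc m ≡ 1
[m*m]%[1+m]≡1 (suc m) _ = trans (cong (_% (2 + m)) (square m)) ([m+kn]%n≡m%n 1 m (2 + m))
  where
  square : ∀ m → suc m * suc m ≡ 1 + m * (2 + m)
  square = ℕ-Solver.solve-∀

2[m∸n]+[2n∸m]≡m : ∀ {m n} → n ≤ m → m ≤ 2 * n → 2 * (m ∸ n) + (2 * n ∸ m) ≡ m
2[m∸n]+[2n∸m]≡m {m} {n} n≤m m≤2n = begin
  2 * u + v          ≡⟨ cong (λ x → u + x + v) (+-identityʳ u) ⟩
  u + u + v          ≡⟨ +-assoc u u v ⟩
  u + (u + v)        ≡⟨ cong (_+_ u) u+v≡n ⟩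
  u + n              ≡⟨ +-comm u n ⟩
  n + u              ≡⟨ m+[n∸m]≡n n≤m ⟩
  m                  ∎
  where
  open ≡-Reasoning
  u = m ∸ n
  v = 2 * n ∸ m
  u+v≡n : u + v ≡ n
  u+v≡n = +-cancelˡ-≡ n (u + v) n (begin
    n + (u + v)      ≡⟨ +-assoc n u v ⟨
    n + u + v        ≡⟨ cong (_+ v) (m+[n∸m]≡n n≤m) ⟩
    m + v            ≡⟨ m+[n∸m]≡n m≤2n ⟩
    2 * n            ≡⟨ cong (_+_ n) (+-identityʳ n) ⟩
    n + n            ∎)

-- When 2e ≥ p, e divides p − j < 2e, so p − j = e and d = 2e − p divides 2j + d = p.
double-divisor : ∀ {p j d e} .{{_ : NonZero p}} → Prime p → 0 < j → j < p → d ∣ j → e ∣ p ∸ j → e < p →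
                 d ≡ 2 * e % p → d ≡ 1 ⊎ e ≡ 1
double-divisor {p} {j} {d} {e} p-prime 0<j j<p d∣j e∣p∸j e<p d≡2e%p with 2 * e <? p
... | yes 2e<p = inj₂ (prime∧∣∧<⇒≡1 p-prime (∣∧∣∸⇒∣ (<⇒≤ j<p) (∣-trans e∣d d∣j) e∣p∸j) e<p)
  where
  e∣d : e ∣ d
  e∣d = subst (e ∣_) (sym (trans d≡2e%p (m<n⇒m%n≡m 2e<p))) (n∣m*n 2)
... | no 2e≮p = inj₁ (prime∧∣∧<⇒≡1 p-prime d∣p d<p)
  where
  p≤2e : p ≤ 2 * e
  p≤2e = ≮⇒≥ 2e≮p
  d<p : d < p
  d<p = subst (_< p) (sym d≡2e%p) (m%n<n (2 * e) p)
  d≡2e∸p : d ≡ 2 * e ∸ p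
  d≡2e∸p = trans d≡2e%p (trans (sym (m≤n⇒[n∸m]%m≡n%m p≤2e)) (m<n⇒m%n≡m (m<n+o⇒m∸n<o (2 * e) p 2e<p+p)))
    where
    2e<p+p : 2 * e < p + p
    2e<p+p = subst (_< p + p) (cong (_+_ e) (sym (+-identityʳ e))) (+-mono-< e<p e<p)
  p∸j≡e : p ∸ j ≡ e
  p∸j≡e = ∣∧<2*⇒≡ e∣p∸j (m<n⇒0<n∸m j<p) (<-≤-trans (∸-monoʳ-< 0<j (<⇒≤ j<p)) p≤2e)
  j≡p∸e : j ≡ p ∸ e
  j≡p∸e = trans (sym (m∸[m∸n]≡n (<⇒≤ j<p))) (cong (p ∸_) p∸j≡e)
  d∣p : d ∣ p
  d∣p = subst (d ∣_) (trans (cong₂ (λ a b → 2 * a + b) j≡p∸e d≡2e∸p) (2[m∸n]+[2n∸m]≡m (<⇒≤ e<p) p≤2e))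
              (∣m∣n⇒∣m+n (∣n⇒∣m*n 2 d∣j) ∣-refl)

prime∤! : ∀ {p} → Prime p → ∀ {m} → m < p → ¬ p ∣ m !
prime∤! p-prime {zero}  _   p∣1 = nonTrivial⇒≢1 {{prime⇒nonTrivial p-prime}} (∣1⇒≡1 p∣1)
prime∤! p-prime {suc m} m<p p∣m! with euclidsLemma (suc m) (m !) p-prime p∣m!
... | inj₁ p∣1+m = <⇒≱ m<p (∣⇒≤ p∣1+m)
... | inj₂ p∣m!  = prime∤! p-prime (<-trans (n<1+n m) m<p) p∣m!

Fin-injective⇒surjective : ∀ {n} (f : Fin n → Fin n) → Injective _≡_ _≡_ f → ∀ y → ∃ λ x → f x ≡ y
Fin-injective⇒surjective {suc n} f f-inj y with Fin.any? (λ x → f x Fin.≟ y)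
... | yes hit = hit
... | no miss = contradiction (Fin.injective⇒≤ g-inj) (<-irrefl refl)
  where
  g : Fin (suc n) → Fin n
  g x = punchOut {i = y} {j = f x} (miss ∘ (x ,_) ∘ sym)
  g-inj : Injective _≡_ _≡_ g
  g-inj {x} {x′} = f-inj ∘ Fin.punchOut-injective {i = y} (miss ∘ (x ,_) ∘ sym) (miss ∘ (x′ ,_) ∘ sym)

-- Coefficients of the divisor polynomials

mono-hit : ∀ {t k} → k ≡ t → mono t k ≡ 1ℤ
mono-hit {t} {k} k≡t with k ≡ᵇ t in eq
... | true  = refl
... | false = contradiction (≡⇒≡ᵇ k t k≡t) (subst T eq)

mono-miss : ∀ {t k} → k ≢ t → mono t k ≡ 0ℤ
mono-miss {t} {k} k≢t with k ≡ᵇ t in eq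
... | true  = contradiction (≡ᵇ⇒≡ k t (subst T (sym eq) _)) k≢t
... | false = refl

module _ (j : ℕ) (g : ℕ → Poly) (i : ℕ) {m : ℕ} where

  sumDivs-∣ : suc m ∣ j → sumDivs j (suc m) g i ≡ sumDivs j m g i ℤ.+ g (suc m) i
  sumDivs-∣ m∣j = cong (λ b → (if b then sumDivs j m g ⊕ g (suc m) else sumDivs j m g) i)
                       (dec-true (suc m ∣? j) m∣j)

  sumDivs-∤ : ¬ suc m ∣ j → sumDivs j (suc m) g i ≡ sumDivs j m g i
  sumDivs-∤ ¬m∣j = cong (λ b → (if b then sumDivs j m g ⊕ g (suc m) else sumDivs j m g) i)
                        (dec-false (suc m ∣? j) ¬m∣j)

module _ (t : ℕ → ℕ) (j k : ℕ) where

  sumDivs-coeff-none : ∀ m → (∀ {d} → d ≤ m → d ∣ j → t d ≢ k) →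
                       sumDivs j m (λ d → mono (t d)) k ≡ 0ℤ
  sumDivs-coeff-none zero    _    = refl
  sumDivs-coeff-none (suc m) none with suc m ∣? j
  ... | yes m∣j = trans (sumDivs-∣ j _ k m∣j)
                        (cong₂ ℤ._+_ (sumDivs-coeff-none m (λ d≤m → none (m≤n⇒m≤1+n d≤m)))
                                     (mono-miss (none ≤-refl m∣j ∘ sym)))
  ... | no ¬m∣j = trans (sumDivs-∤ j _ k ¬m∣j) (sumDivs-coeff-none m (λ d≤m → none (m≤n⇒m≤1+n d≤m)))

  sumDivs-coeff-unique : ∀ m {d₀} → 0 < d₀ → d₀ ≤ m → d₀ ∣ j → t d₀ ≡ k →
                         (∀ {d} → d ∣ j → t d ≡ k → d ≡ d₀) →
                         sumDivs j m (λ d → mono (t d)) k ≡ 1ℤ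
  sumDivs-coeff-unique zero    (s≤s _) ()
  sumDivs-coeff-unique (suc m) 0<d₀ d₀≤1+m d₀∣j td₀ unique with suc m ∣? j | m≤n⇒m<n∨m≡n d₀≤1+m
  ... | yes m∣j | inj₂ refl =
    trans (sumDivs-∣ j _ k m∣j) (cong₂ ℤ._+_ (sumDivs-coeff-none m others) (mono-hit (sym td₀)))
    where
    others : ∀ {d} → d ≤ m → d ∣ j → t d ≢ k
    others d≤m d∣j td≡k = <⇒≢ (s≤s d≤m) (unique d∣j td≡k)
  ... | no ¬m∣j | inj₂ refl = contradiction d₀∣j ¬m∣j
  ... | yes m∣j | inj₁ d₀<1+m = trans (sumDivs-∣ j _ k m∣j)
    (cong₂ ℤ._+_ (sumDivs-coeff-unique m 0<d₀ (s≤s⁻¹ d₀<1+m) d₀∣j td₀ unique)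
                 (mono-miss λ k≡ → <⇒≢ d₀<1+m (sym (unique m∣j (sym k≡)))))
  ... | no ¬m∣j | inj₁ d₀<1+m =
    trans (sumDivs-∤ j _ k ¬m∣j) (sumDivs-coeff-unique m 0<d₀ (s≤s⁻¹ d₀<1+m) d₀∣j td₀ unique)

h-coeff-none : ∀ t j k → (∀ {d} → d ∣ j → t d ≢ k) → h t j k ≡ 0ℤ
h-coeff-none t j k none = sumDivs-coeff-none t j k j (λ _ → none)

h-coeff-unique : ∀ t j k {d₀} → 0 < j → d₀ ∣ j → t d₀ ≡ k →
                 (∀ {d} → d ∣ j → t d ≡ k → d ≡ d₀) → h t j k ≡ 1ℤ
h-coeff-unique t j k 0<j d₀∣j =
  sumDivs-coeff-unique t j k j (∣⇒pos 0<j d₀∣j) (∣⇒≤ {{>-nonZero 0<j}} d₀∣j) d₀∣j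

⟦_⟧ : ∀ {a} {A : Set a} → Dec A → ℤ
⟦ yes _ ⟧ = 1ℤ
⟦ no  _ ⟧ = 0ℤ

⟦⟧-cong : ∀ {a b} {A : Set a} {B : Set b} → (A → B) → (B → A) →
          (a? : Dec A) (b? : Dec B) → ⟦ a? ⟧ ≡ ⟦ b? ⟧
⟦⟧-cong _   _   (yes _) (yes _) = refl
⟦⟧-cong _   _   (no  _) (no  _) = refl
⟦⟧-cong A→B _   (yes a) (no ¬b) = contradiction (A→B a) ¬b
⟦⟧-cong _   B→A (no ¬a) (yes b) = contradiction (B→A b) ¬a

⟦⟧-yes : ∀ {a} {A : Set a} (a? : Dec A) → A → ⟦ a? ⟧ ≡ 1ℤ
⟦⟧-yes (yes _) _ = refl
⟦⟧-yes (no ¬a) a = contradiction a ¬a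

⟦⟧-no : ∀ {a} {A : Set a} (a? : Dec A) → ¬ A → ⟦ a? ⟧ ≡ 0ℤ
⟦⟧-no (yes a) ¬a = contradiction a ¬a
⟦⟧-no (no _)  _  = refl

h-coeff-indicator : ∀ t j k d₀ → 0 < j → t d₀ ≡ k →
                    (∀ {d} → d ∣ j → t d ≡ k → d ≡ d₀) → h t j k ≡ ⟦ d₀ ∣? j ⟧
h-coeff-indicator t j k d₀ 0<j td₀ unique with d₀ ∣? j
... | yes d₀∣j = h-coeff-unique t j k 0<j d₀∣j td₀ unique
... | no ¬d₀∣j = h-coeff-none t j k λ d∣j td≡k → ¬d₀∣j (subst (_∣ j) (unique d∣j td≡k) d∣j)

sumBelow-zero : ∀ n f → (∀ {k} → k < n → f k ≡ 0ℤ) → sumBelow n f ≡ 0ℤ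
sumBelow-zero zero    f _   = refl
sumBelow-zero (suc n) f f≡0 = cong₂ ℤ._+_ (sumBelow-zero n f (f≡0 ∘ m<n⇒m<1+n)) (f≡0 (n<1+n n))

h⊛h-coeff-none : ∀ t u j m i → (∀ {d e} → d ∣ j → e ∣ m → t d + u e ≢ i) →
                 (h t j ⊛ h u m) i ≡ 0ℤ
h⊛h-coeff-none t u j m i none = sumBelow-zero (suc i) _ (summand ∘ s≤s⁻¹)
  where
  summand : ∀ {k} → k ≤ i → h t j k ℤ.* h u m (i ∸ k) ≡ 0ℤ
  summand {k} k≤i with h u m (i ∸ k) ℤP.≟ 0ℤ
  ... | yes b≡0 = trans (cong (h t j k ℤ.*_) b≡0) (ℤP.*-zeroʳ (h t j k))
  ... | no  b≢0 = trans (cong (ℤ._* h u m (i ∸ k)) (h-coeff-none t j k a≢0))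
                        (ℤP.*-zeroˡ (h u m (i ∸ k)))
    where
    a≢0 : ∀ {d} → d ∣ j → t d ≢ k
    a≢0 d∣j td≡k = b≢0 (h-coeff-none u m (i ∸ k) λ e∣m ue≡ →
      none d∣j e∣m (trans (cong₂ _+_ td≡k ue≡) (m+[n∸m]≡n k≤i)))

Natural : ℤ → Set
Natural z = ∃ λ n → z ≡ + n

NaturalPoly : Poly → Set
NaturalPoly P = ∀ i → Natural (P i)

+-natural : ∀ {a b} → Natural a → Natural b → Natural (a ℤ.+ b)
+-natural (m , refl) (n , refl) = m + n , sym (ℤP.pos-+ m n)

*-natural : ∀ {a b} → Natural a → Natural b → Natural (a ℤ.* b)
*-natural (m , refl) (n , refl) = m * n , sym (ℤP.pos-* m n)

⊕-natural : ∀ {P Q} → NaturalPoly P → NaturalPoly Q → NaturalPoly (P ⊕ Q)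
⊕-natural P≥0 Q≥0 i = +-natural (P≥0 i) (Q≥0 i)

mono-natural : ∀ t → NaturalPoly (mono t)
mono-natural t i with i ≡ᵇ t
... | true  = 1 , refl
... | false = 0 , refl

sumBelow-natural : ∀ n f → (∀ k → Natural (f k)) → Natural (sumBelow n f)
sumBelow-natural zero    f _   = 0 , refl
sumBelow-natural (suc n) f f≥0 = +-natural (sumBelow-natural n f f≥0) (f≥0 n)

⊛-natural : ∀ {P Q} → NaturalPoly P → NaturalPoly Q → NaturalPoly (P ⊛ Q)
⊛-natural P≥0 Q≥0 i = sumBelow-natural (suc i) _ λ k → *-natural (P≥0 k) (Q≥0 (i ∸ k))

sumDivs-natural : ∀ j m g → (∀ d → NaturalPoly (g d)) → NaturalPoly (sumDivs j m g)
sumDivs-natural j zero    g _   i = 0 , refl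
sumDivs-natural j (suc m) g g≥0 = if-natural (does (suc m ∣? j))
  (⊕-natural (sumDivs-natural j m g g≥0) (g≥0 (suc m))) (sumDivs-natural j m g g≥0)
  where
  if-natural : ∀ b {P Q} → NaturalPoly P → NaturalPoly Q → NaturalPoly (if b then P else Q)
  if-natural true  P≥0 _   = P≥0
  if-natural false _   Q≥0 = Q≥0

sumPoly-natural : ∀ n P → (∀ j → NaturalPoly (P j)) → NaturalPoly (sumPoly n P)
sumPoly-natural zero    P _   i = 0 , refl
sumPoly-natural (suc n) P P≥0 = ⊕-natural (sumPoly-natural n P P≥0) (P≥0 (suc n))

fχ-natural : ∀ p → NaturalPoly (fχ p)
fχ-natural p = sumPoly-natural (p ∸ 1) _ λ j →
  ⊛-natural (h-natural (tχ p) j) (h-natural (tχbar p) (p ∸ j))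
  where
  h-natural : ∀ t j → NaturalPoly (h t j)
  h-natural t j = sumDivs-natural j j _ (mono-natural ∘ t)

natural⇒nonNegative : ∀ {z} → Natural z → 0ℤ ℤ.≤ z
natural⇒nonNegative (_ , refl) = ℤ.+≤+ z≤n

sum₁ : ℕ → (ℕ → ℤ) → ℤ
sum₁ zero    f = 0ℤ
sum₁ (suc n) f = sum₁ n f ℤ.+ f (suc n)

sumPoly-coeff : ∀ n P i → sumPoly n P i ≡ sum₁ n (λ j → P j i)
sumPoly-coeff zero    P i = refl
sumPoly-coeff (suc n) P i = cong (ℤ._+ P (suc n) i) (sumPoly-coeff n P i)

sum₁-cong : ∀ n {f g} → (∀ {j} → 0 < j → j ≤ n → f j ≡ g j) → sum₁ n f ≡ sum₁ n g
sum₁-cong zero    _   = refl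
sum₁-cong (suc n) f≡g = cong₂ ℤ._+_ (sum₁-cong n λ 0<j j≤n → f≡g 0<j (m≤n⇒m≤1+n j≤n)) (f≡g z<s ≤-refl)

sum₁-+ : ∀ n f g → sum₁ n (λ j → f j ℤ.+ g j) ≡ sum₁ n f ℤ.+ sum₁ n g
sum₁-+ zero    f g = refl
sum₁-+ (suc n) f g = begin
  sum₁ n (λ j → f j ℤ.+ g j) ℤ.+ (f (suc n) ℤ.+ g (suc n))
    ≡⟨ cong (ℤ._+ (f (suc n) ℤ.+ g (suc n))) (sum₁-+ n f g) ⟩
  sum₁ n f ℤ.+ sum₁ n g ℤ.+ (f (suc n) ℤ.+ g (suc n))
    ≡⟨ interchange (sum₁ n f) (sum₁ n g) (f (suc n)) (g (suc n)) ⟩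
  sum₁ n f ℤ.+ f (suc n) ℤ.+ (sum₁ n g ℤ.+ g (suc n)) ∎
  where
  open ≡-Reasoning
  open import Algebra.Properties.CommutativeSemigroup ℤP.+-commutativeSemigroup using (interchange)

sum₁-zero : ∀ n → sum₁ n (λ _ → 0ℤ) ≡ 0ℤ
sum₁-zero zero    = refl
sum₁-zero (suc n) = cong (ℤ._+ 0ℤ) (sum₁-zero n)

sum₁-ones : ∀ n → sum₁ n (λ _ → 1ℤ) ≡ + n
sum₁-ones zero    = refl
sum₁-ones (suc n) = trans (cong (ℤ._+ 1ℤ) (sum₁-ones n)) (trans (sym (ℤP.pos-+ n 1)) (cong +_ (+-comm n 1)))

sum₁-≟-below : ∀ {n c} → n < c → sum₁ n (λ j → ⟦ j ≟ c ⟧) ≡ 0ℤ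
sum₁-≟-below {zero}  _     = refl
sum₁-≟-below {suc n} 1+n<c =
  cong₂ ℤ._+_ (sum₁-≟-below (<-trans (n<1+n n) 1+n<c)) (⟦⟧-no (suc n ≟ _) (<⇒≢ 1+n<c))

sum₁-≟ : ∀ {n c} → 0 < c → c ≤ n → sum₁ n (λ j → ⟦ j ≟ c ⟧) ≡ 1ℤ
sum₁-≟ {zero}  (s≤s _) ()
sum₁-≟ {suc n} 0<c c≤1+n with m≤n⇒m<n∨m≡n c≤1+n
... | inj₁ c<1+n = cong₂ ℤ._+_ (sum₁-≟ 0<c (s≤s⁻¹ c<1+n)) (⟦⟧-no (suc n ≟ _) (>⇒≢ c<1+n))
... | inj₂ refl  = cong₂ ℤ._+_ (sum₁-≟-below (n<1+n n)) (⟦⟧-yes (suc n ≟ suc n) refl)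

sum₁-even : ∀ q → sum₁ (2 * q) (λ j → ⟦ 2 ∣? j ⟧) ≡ + q
sum₁-even zero    = refl
sum₁-even (suc q) = begin
  sum₁ (2 * suc q) ind                                   ≡⟨ cong (λ n → sum₁ n ind) (2*[1+q] q) ⟩
  sum₁ (2 * q) ind ℤ.+ ind (1 + 2 * q) ℤ.+ ind (2 + 2 * q) ≡⟨ cong₂ (λ a b → a ℤ.+ b ℤ.+ ind (2 + 2 * q))
                                                                 (sum₁-even q) (⟦⟧-no (2 ∣? _) (odd∤ q)) ⟩
  + q ℤ.+ 0ℤ ℤ.+ ind (2 + 2 * q)                        ≡⟨ cong (ℤ._+_ (+ q ℤ.+ 0ℤ)) (⟦⟧-yes (2 ∣? _) even) ⟩
  + q ℤ.+ 0ℤ ℤ.+ 1ℤ                                     ≡⟨ cong (ℤ._+ 1ℤ) (ℤP.+-identityʳ (+ q)) ⟩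
  + q ℤ.+ 1ℤ                                            ≡⟨ trans (sym (ℤP.pos-+ q 1)) (cong +_ (+-comm q 1)) ⟩
  + suc q ∎
  where
  open ≡-Reasoning
  ind : ℕ → ℤ
  ind j = ⟦ 2 ∣? j ⟧
  2*[1+q] : ∀ q → 2 * suc q ≡ 2 + 2 * q
  2*[1+q] q = *-distribˡ-+ 2 1 q
  odd∤ : ∀ q → ¬ 2 ∣ 1 + 2 * q
  odd∤ q 2∣1+2q = contradiction (∣1⇒≡1 (∣m+n∣m⇒∣n (subst (2 ∣_) (+-comm 1 (2 * q)) 2∣1+2q) (m∣m*n q))) λ ()
  even : 2 ∣ 2 + 2 * q
  even = divides (suc q) (trans (sym (2*[1+q] q)) (*-comm 2 (suc q)))

-- Gauss's lemma for the residue 2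

∏< : ℕ → (ℕ → ℕ) → ℕ
∏< zero    f = 1
∏< (suc n) f = ∏< n f * f n

∏<-+ : ∀ m n f → ∏< (m + n) f ≡ ∏< m f * ∏< n (λ i → f (m + i))
∏<-+ m zero    f = trans (cong (λ k → ∏< k f) (+-identityʳ m)) (sym (*-identityʳ (∏< m f)))
∏<-+ m (suc n) f = begin
  ∏< (m + suc n) f                                     ≡⟨ cong (λ k → ∏< k f) (+-suc m n) ⟩
  ∏< (m + n) f * f (m + n)                             ≡⟨ cong (_* f (m + n)) (∏<-+ m n f) ⟩
  ∏< m f * ∏< n (λ i → f (m + i)) * f (m + n)          ≡⟨ *-assoc (∏< m f) _ _ ⟩
  ∏< m f * (∏< n (λ i → f (m + i)) * f (m + n))        ∎
  where open ≡-Reasoning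

∏<-reverse : ∀ n f → ∏< n f ≡ ∏< n (λ i → f (n ∸ suc i))
∏<-reverse zero    f = refl
∏<-reverse (suc n) f = begin
  ∏< n f * f n                                 ≡⟨ cong (_* f n) (∏<-reverse n f) ⟩
  ∏< n (λ i → f (n ∸ suc i)) * f n             ≡⟨ *-comm _ (f n) ⟩
  f n * ∏< n (λ i → f (n ∸ suc i))             ≡⟨ cong (_* ∏< n (λ i → f (n ∸ suc i))) (*-identityˡ (f n)) ⟨
  1 * f n * ∏< n (λ i → f (n ∸ suc i))         ≡⟨ ∏<-+ 1 n (λ i → f (suc n ∸ suc i)) ⟨
  ∏< (suc n) (λ i → f (suc n ∸ suc i))         ∎
  where open ≡-Reasoning

2^n*n!≡∏<evens : ∀ n → 2 ^ n * n ! ≡ ∏< n (λ k → 2 * suc k)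
2^n*n!≡∏<evens zero    = refl
2^n*n!≡∏<evens (suc n) =
  trans (rearrange (2 ^ n) (n !) n) (cong (_* (2 * suc n)) (2^n*n!≡∏<evens n))
  where
  rearrange : ∀ a b n → 2 * a * (suc n * b) ≡ a * b * (2 * suc n)
  rearrange = ℕ-Solver.solve-∀

[2s+1]!≡evens*odds : ∀ s → (2 * s + 1) ! ≡ ∏< s (λ k → 2 * suc k) * ∏< (suc s) (λ k → 2 * k + 1)
[2s+1]!≡evens*odds zero    = refl
[2s+1]!≡evens*odds (suc s) = begin
  (2 * suc s + 1) !                           ≡⟨ cong _! (unfold s) ⟩
  (2 + m) * ((1 + m) * m !)                   ≡⟨ cong (λ x → (2 + m) * ((1 + m) * x)) ([2s+1]!≡evens*odds s) ⟩
  (2 + m) * ((1 + m) * (E * O))               ≡⟨ rearrange s E O ⟩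
  E * (2 * suc s) * (O * (2 * suc s + 1))     ∎
  where
  open ≡-Reasoning
  m = 2 * s + 1
  E = ∏< s (λ k → 2 * suc k)
  O = ∏< (suc s) (λ k → 2 * k + 1)
  unfold : ∀ s → 2 * suc s + 1 ≡ 2 + (2 * s + 1)
  unfold = ℕ-Solver.solve-∀
  rearrange : ∀ s E O → (2 + (2 * s + 1)) * ((1 + (2 * s + 1)) * (E * O)) ≡
                         E * (2 * suc s) * (O * (2 * suc s + 1))
  rearrange = ℕ-Solver.solve-∀

∏<-complement : ∀ p n (a b : ℕ → ℕ) → (∀ {i} → i < n → a i + b i ≡ p) →
                ∃ λ c → + ∏< n a ≡ -1ℤ ℤ.^ n ℤ.* + ∏< n b ℤ.+ c ℤ.* + p
∏<-complement p zero    a b _     = 0ℤ , refl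
∏<-complement p (suc n) a b a+b≡p with ∏<-complement p n a b (a+b≡p ∘ m<n⇒m<1+n)
... | c , IH = σ ℤ.* B ℤ.+ c ℤ.* x , (begin
  + (∏< n a * a n)                              ≡⟨ ℤP.pos-* (∏< n a) (a n) ⟩
  + ∏< n a ℤ.* x                                ≡⟨ cong (ℤ._* x) IH ⟩
  (σ ℤ.* B ℤ.+ c ℤ.* + p) ℤ.* x                 ≡⟨ cong (λ z → (σ ℤ.* B ℤ.+ c ℤ.* z) ℤ.* x) p≡x+y ⟩
  (σ ℤ.* B ℤ.+ c ℤ.* (x ℤ.+ y)) ℤ.* x           ≡⟨ step σ B c x y ⟩
  -1ℤ ℤ.* σ ℤ.* (B ℤ.* y) ℤ.+ (σ ℤ.* B ℤ.+ c ℤ.* x) ℤ.* (x ℤ.+ y)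
    ≡⟨ cong₂ (λ u v → -1ℤ ℤ.* σ ℤ.* u ℤ.+ (σ ℤ.* B ℤ.+ c ℤ.* x) ℤ.* v) (ℤP.pos-* (∏< n b) (b n)) p≡x+y ⟨
  -1ℤ ℤ.* σ ℤ.* + (∏< n b * b n) ℤ.+ (σ ℤ.* B ℤ.+ c ℤ.* x) ℤ.* + p ∎)
  where
  open ≡-Reasoning
  σ = -1ℤ ℤ.^ n
  B = + ∏< n b
  x = + a n
  y = + b n
  p≡x+y : + p ≡ x ℤ.+ y
  p≡x+y = trans (cong +_ (sym (a+b≡p (n<1+n n)))) (ℤP.pos-+ (a n) (b n))
  step : ∀ σ B c x y → (σ ℤ.* B ℤ.+ c ℤ.* (x ℤ.+ y)) ℤ.* x ≡
                       -1ℤ ℤ.* σ ℤ.* (B ℤ.* y) ℤ.+ (σ ℤ.* B ℤ.+ c ℤ.* x) ℤ.* (x ℤ.+ y)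
  step = ℤ-Solver.solve-∀

-1^[2r]≡1 : ∀ r → -1ℤ ℤ.^ (2 * r) ≡ 1ℤ
-1^[2r]≡1 zero    = refl
-1^[2r]≡1 (suc r) = begin
  -1ℤ ℤ.^ (2 * suc r)               ≡⟨ cong (-1ℤ ℤ.^_) (*-distribˡ-+ 2 1 r) ⟩
  -1ℤ ℤ.^ (2 + 2 * r)               ≡⟨ ℤP.^-distribˡ-+-* -1ℤ 2 (2 * r) ⟩
  1ℤ ℤ.* -1ℤ ℤ.^ (2 * r)            ≡⟨ cong (1ℤ ℤ.*_) (-1^[2r]≡1 r) ⟩
  1ℤ                                ∎
  where open ≡-Reasoning

-- 2^q q! is the product of the evens 2, …, 2s and of the s + 1 evens above p/2, and the
-- latter are p minus the odd numbers up to q.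
2^q*q!≡±q! : ∀ s → let q = 2 * s + 1 in
             ∃ λ c → + (2 ^ q * q !) ≡ -1ℤ ℤ.^ suc s ℤ.* + (q !) ℤ.+ c ℤ.* + suc (2 * q)
2^q*q!≡±q! s = + E ℤ.* c , (begin
  + (2 ^ q * q !)                         ≡⟨ cong +_ 2^q*q!≡E*A ⟩
  + (E * A)                               ≡⟨ ℤP.pos-* E A ⟩
  + E ℤ.* + A                             ≡⟨ cong (+ E ℤ.*_) A≡ ⟩
  + E ℤ.* (σ ℤ.* + O ℤ.+ c ℤ.* + P)       ≡⟨ distrib (+ E) σ (+ O) c (+ P) ⟩
  σ ℤ.* (+ E ℤ.* + O) ℤ.+ + E ℤ.* c ℤ.* + P
    ≡⟨ cong (λ z → σ ℤ.* z ℤ.+ + E ℤ.* c ℤ.* + P) (trans (cong +_ ([2s+1]!≡evens*odds s)) (ℤP.pos-* E O)) ⟨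
  σ ℤ.* + (q !) ℤ.+ + E ℤ.* c ℤ.* + P       ∎)
  where
  open ≡-Reasoning
  q = 2 * s + 1
  P = suc (2 * q)
  σ = -1ℤ ℤ.^ suc s
  even odd a : ℕ → ℕ
  even k = 2 * suc k
  odd k = 2 * k + 1
  a i = even (s + (s ∸ i))
  E = ∏< s even
  A = ∏< (suc s) a
  O = ∏< (suc s) odd
  a+odd≡P : ∀ {i} → i < suc s → a i + odd i ≡ P
  a+odd≡P {i} i<1+s = begin
    even (s + (s ∸ i)) + odd i               ≡⟨ cong (λ z → even (z + (s ∸ i)) + odd i) s≡ ⟨
    even ((s ∸ i + i) + (s ∸ i)) + odd i     ≡⟨ pair (s ∸ i) i ⟩
    suc (2 * (2 * (s ∸ i + i) + 1))          ≡⟨ cong (λ z → suc (2 * (2 * z + 1))) s≡ ⟩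
    P                                        ∎
    where
    s≡ : s ∸ i + i ≡ s
    s≡ = m∸n+n≡m (s≤s⁻¹ i<1+s)
    pair : ∀ u i → 2 * suc ((u + i) + u) + (2 * i + 1) ≡ suc (2 * (2 * (u + i) + 1))
    pair = ℕ-Solver.solve-∀
  2^q*q!≡E*A : 2 ^ q * q ! ≡ E * A
  2^q*q!≡E*A = begin
    2 ^ q * q !                                 ≡⟨ 2^n*n!≡∏<evens q ⟩
    ∏< q even                                   ≡⟨ cong (λ k → ∏< k even) (split s) ⟩
    ∏< (s + suc s) even                         ≡⟨ ∏<-+ s (suc s) even ⟩
    E * ∏< (suc s) (λ i → even (s + i))         ≡⟨ cong (E *_) (∏<-reverse (suc s) (λ i → even (s + i))) ⟩
    E * A                                       ∎
    where
    split : ∀ s → 2 * s + 1 ≡ s + suc s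
    split = ℕ-Solver.solve-∀
  c : ℤ
  c = proj₁ (∏<-complement P (suc s) a odd a+odd≡P)
  A≡ : + A ≡ σ ℤ.* + O ℤ.+ c ℤ.* + P
  A≡ = proj₂ (∏<-complement P (suc s) a odd a+odd≡P)
  distrib : ∀ e σ o c p → e ℤ.* (σ ℤ.* o ℤ.+ c ℤ.* p) ≡ σ ℤ.* (e ℤ.* o) ℤ.+ e ℤ.* c ℤ.* p
  distrib = ℤ-Solver.solve-∀

2q+1∣[2^q+1]*q! : ∀ r → let q = 2 * (2 * r) + 1 in suc (2 * q) ∣ (2 ^ q + 1) * q !
2q+1∣[2^q+1]*q! r = divides ℤ.∣ c ∣ (begin
  (2 ^ q + 1) * q !                       ≡⟨ cong ℤ.∣_∣ (begin
    + ((2 ^ q + 1) * q !)                 ≡⟨ cong +_ (*-distribʳ-+ (q !) (2 ^ q) 1) ⟩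
    + (2 ^ q * q ! + 1 * q !)             ≡⟨ cong (λ z → + (2 ^ q * q ! + z)) (*-identityˡ (q !)) ⟩
    + (2 ^ q * q ! + q !)                 ≡⟨ ℤP.pos-+ (2 ^ q * q !) (q !) ⟩
    + (2 ^ q * q !) ℤ.+ + (q !)           ≡⟨ cong (ℤ._+ + (q !)) 2^q*q!≡ ⟩
    σ ℤ.* + (q !) ℤ.+ c ℤ.* P ℤ.+ + (q !) ≡⟨ cong (λ z → z ℤ.* + (q !) ℤ.+ c ℤ.* P ℤ.+ + (q !)) σ≡-1 ⟩
    -1ℤ ℤ.* + (q !) ℤ.+ c ℤ.* P ℤ.+ + (q !) ≡⟨ cancel (+ (q !)) (c ℤ.* P) ⟩
    c ℤ.* P                               ∎) ⟩
  ℤ.∣ c ℤ.* P ∣                           ≡⟨ ℤP.abs-* c P ⟩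
  ℤ.∣ c ∣ * suc (2 * q)                   ∎)
  where
  open ≡-Reasoning
  q = 2 * (2 * r) + 1
  P = + suc (2 * q)
  σ = -1ℤ ℤ.^ suc (2 * r)
  c : ℤ
  c = proj₁ (2^q*q!≡±q! (2 * r))
  2^q*q!≡ : + (2 ^ q * q !) ≡ σ ℤ.* + (q !) ℤ.+ c ℤ.* P
  2^q*q!≡ = proj₂ (2^q*q!≡±q! (2 * r))
  σ≡-1 : σ ≡ -1ℤ
  σ≡-1 = cong (-1ℤ ℤ.*_) (-1^[2r]≡1 r)
  cancel : ∀ x y → -1ℤ ℤ.* x ℤ.+ y ℤ.+ x ≡ y
  cancel = ℤ-Solver.solve-∀

2q+1∣2^q+1 : ∀ {r q} → q ≡ 2 * (2 * r) + 1 → Prime (suc (2 * q)) → suc (2 * q) ∣ 2 ^ q + 1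
2q+1∣2^q+1 {r} {q} q≡4r+1 p-prime =
  [ (λ p∣2^q+1 → p∣2^q+1) , (λ p∣q! → contradiction p∣q! (prime∤! p-prime (s≤s (m≤n*m q 2)))) ]′
    (euclidsLemma (2 ^ q + 1) (q !) p-prime
       (subst (λ q → suc (2 * q) ∣ (2 ^ q + 1) * q !) (sym q≡4r+1) (2q+1∣[2^q+1]*q! r)))

-- Powers of 2 modulo a prime

module PowersOfTwo {p : ℕ} (p-prime : Prime p) (2<p : 2 < p) where

  instance
    p≢0 : NonZero p
    p≢0 = prime⇒nonZero p-prime

  pow2 : ℕ → ℕ
  pow2 k = 2 ^ k % p

  pow2<p : ∀ k → pow2 k < p
  pow2<p k = m%n<n (2 ^ k) p

  pow2-0 : pow2 0 ≡ 1
  pow2-0 = m<n⇒m%n≡m (<-trans (n<1+n 1) 2<p)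

  pow2-1 : pow2 1 ≡ 2
  pow2-1 = m<n⇒m%n≡m 2<p

  pow2-+ : ∀ a b → pow2 (a + b) ≡ pow2 a * pow2 b % p
  pow2-+ a b = trans (cong (_% p) (^-distribˡ-+-* 2 a b)) (%-distribˡ-* (2 ^ a) (2 ^ b) p)

  pow2-suc : ∀ k → pow2 (suc k) ≡ 2 * pow2 k % p
  pow2-suc k = trans (pow2-+ 1 k) (cong (λ z → z * pow2 k % p) pow2-1)

  p∤2^ : ∀ k → ¬ p ∣ 2 ^ k
  p∤2^ zero    p∣1   = contradiction (∣⇒≤ p∣1) (<⇒≱ (<-trans (n<1+n 1) 2<p))
  p∤2^ (suc k) p∣2^k with euclidsLemma 2 (2 ^ k) p-prime p∣2^k
  ... | inj₁ p∣2 = contradiction (∣⇒≤ p∣2) (<⇒≱ 2<p)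
  ... | inj₂ p∣2^k = p∤2^ k p∣2^k

  pow2≢0 : ∀ k → pow2 k ≢ 0
  pow2≢0 k = p∤2^ k ∘ m%n≡0⇒n∣m (2 ^ k) p

  private
    double-cancel : ∀ {x y} → y ≤ x → x < p → 2 * x % p ≡ 2 * y % p → x ≡ y
    double-cancel {x} {y} y≤x x<p 2x≡2y with euclidsLemma 2 (x ∸ y) p-prime
                                            (subst (p ∣_) (sym (*-distribˡ-∸ 2 x y)) (%≡%⇒∣∸ p 2x≡2y))
    ... | inj₁ p∣2   = contradiction (∣⇒≤ p∣2) (<⇒≱ 2<p)
    ... | inj₂ p∣x∸y = ≤-antisym (m∸n≡0⇒m≤n (∣∧<⇒≡0 p∣x∸y (≤-<-trans (m∸n≤m x y) x<p))) y≤x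

  double-injective : ∀ {x y} → x < p → y < p → 2 * x % p ≡ 2 * y % p → x ≡ y
  double-injective {x} {y} x<p y<p 2x≡2y with ≤-total y x
  ... | inj₁ y≤x = double-cancel y≤x x<p 2x≡2y
  ... | inj₂ x≤y = sym (double-cancel x≤y y<p (sym 2x≡2y))

  pow2-cancelˡ : ∀ a b → pow2 (a + b) ≡ pow2 a → pow2 b ≡ 1
  pow2-cancelˡ zero    b eq = trans eq pow2-0
  pow2-cancelˡ (suc a) b eq = pow2-cancelˡ a b (double-injective (pow2<p (a + b)) (pow2<p a)
    (trans (sym (pow2-suc (a + b))) (trans eq (pow2-suc a))))

  pow2-periodic : ∀ {k} → pow2 k ≡ 1 → ∀ a c → pow2 (a + c * k) ≡ pow2 a
  pow2-periodic _  a zero = cong pow2 (+-identityʳ a)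
  pow2-periodic {k} pow2k≡1 a (suc c) = begin
    pow2 (a + (k + c * k))              ≡⟨ cong (λ m → pow2 (a + m)) (+-comm k (c * k)) ⟩
    pow2 (a + (c * k + k))              ≡⟨ cong pow2 (+-assoc a (c * k) k) ⟨
    pow2 (a + c * k + k)                ≡⟨ pow2-+ (a + c * k) k ⟩
    pow2 (a + c * k) * pow2 k % p       ≡⟨ cong (λ z → pow2 (a + c * k) * z % p) pow2k≡1 ⟩
    pow2 (a + c * k) * 1 % p            ≡⟨ cong (_% p) (*-identityʳ (pow2 (a + c * k))) ⟩
    pow2 (a + c * k) % p                ≡⟨ m%n%n≡m%n (2 ^ (a + c * k)) p ⟩
    pow2 (a + c * k)                    ≡⟨ pow2-periodic pow2k≡1 a c ⟩
    pow2 a                              ∎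
    where open ≡-Reasoning

  pow2-% : ∀ {k} .{{_ : NonZero k}} → pow2 k ≡ 1 → ∀ m → pow2 m ≡ pow2 (m % k)
  pow2-% {k} pow2k≡1 m = trans (cong pow2 (m≡m%n+[m/n]*n m k)) (pow2-periodic pow2k≡1 (m % k) (m / k))

dlogFrom-finds : ∀ p d k fuel {k₀} → k ≤ k₀ → k₀ < k + fuel → modN (2 ^ k₀) p ≡ modN d p →
                 dlogFrom p d k fuel < k + fuel × modN (2 ^ dlogFrom p d k fuel) p ≡ modN d p
dlogFrom-finds p d k zero {k₀} k≤k₀ k₀<k+0 _ = contradiction (subst (k₀ <_) (+-identityʳ k) k₀<k+0) (≤⇒≯ k≤k₀)
dlogFrom-finds p d k (suc fuel) {k₀} k≤k₀ k₀<k+1+f hit with modN (2 ^ k) p ≡ᵇ modN d p in eq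
... | true  = m<m+n k z<s , ≡ᵇ⇒≡ _ _ (subst T (sym eq) _)
... | false = map₁ (subst (dlogFrom p d (suc k) fuel <_) (sym (+-suc k fuel)))
                (dlogFrom-finds p d (suc k) fuel k<k₀ (subst (k₀ <_) (+-suc k fuel) k₀<k+1+f) hit)
  where
  k<k₀ : k < k₀
  k<k₀ = ≤∧≢⇒< k≤k₀ λ { refl → subst T eq (≡⇒≡ᵇ _ _ hit) }

-- p ∣ 2^q + 1 says that 2 is a quadratic non-residue modulo the safe prime p = 2q + 1.
module SafePrime {q : ℕ} (q-prime : Prime q) (p-prime : Prime (suc (2 * q)))
                 (p∣2^q+1 : suc (2 * q) ∣ 2 ^ q + 1) where

  n p : ℕ
  n = 2 * q
  p = suc n

  1<q : 1 < q
  1<q = nonTrivial⇒n>1 q {{prime⇒nonTrivial q-prime}}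

  4<p : 4 < p
  4<p = s≤s (*-monoʳ-≤ 2 1<q)

  1<n : 1 < n
  1<n = ≤-trans (s≤s (s≤s z≤n)) (s≤s⁻¹ 4<p)

  private
    instance
      q≢0 : NonZero q
      q≢0 = prime⇒nonZero q-prime

  0<n : 0 < n
  0<n = <-trans z<s 1<n

  1+q<p : suc q < p
  1+q<p = s≤s (subst (q <_) (*-comm q 2) (m<m*n q 2 (n<1+n 1)))

  open PowersOfTwo p-prime (<-trans (s≤s (s≤s (s≤s z≤n))) 4<p) public

  pow2-q : pow2 q ≡ n
  pow2-q = %-pred-≡0 (trans (cong (_% p) (+-comm 1 (2 ^ q))) (n∣m⇒m%n≡0 _ p p∣2^q+1))

  pow2-n : pow2 n ≡ 1
  pow2-n = begin
    pow2 (q + (q + 0))       ≡⟨ cong (λ m → pow2 (q + m)) (+-identityʳ q) ⟩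
    pow2 (q + q)             ≡⟨ pow2-+ q q ⟩
    pow2 q * pow2 q % p      ≡⟨ cong (λ z → z * z % p) pow2-q ⟩
    n * n % p                ≡⟨ [m*m]%[1+m]≡1 n (<-trans z<s 1<n) ⟩
    1                        ∎
    where open ≡-Reasoning

  -- A least counterexample k divides 2q, as 2^(2q mod k) ≡ 1; it does not divide q, as
  -- 2^q ≡ −1; so k = 2, but 2² = 4 ≢ 1 since p > 4.
  pow2-order : ∀ {k} → 0 < k → k < n → pow2 k ≢ 1
  pow2-order {k} = <-rec (λ k → 0 < k → k < n → pow2 k ≢ 1) step k
    where
    step : ∀ k → (∀ {j} → j < k → 0 < j → j < n → pow2 j ≢ 1) → 0 < k → k < n → pow2 k ≢ 1
    step (suc k) smaller _ k<n pow2k≡1 with n % suc k in n%k≡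
    ... | suc t = smaller t<k z<s (<-trans t<k k<n)
                    (trans (cong pow2 (sym n%k≡)) (trans (sym (pow2-% pow2k≡1 n)) pow2-n))
      where
      t<k : suc t < suc k
      t<k = subst (_< suc k) n%k≡ (m%n<n n (suc k))
    ... | zero = contradiction (subst (λ k → pow2 k ≡ 1) k≡2 pow2k≡1) pow2-2≢1
      where
      k∤q : ¬ suc k ∣ q
      k∤q k∣q = >⇒≢ 1<n (begin
        n                  ≡⟨ pow2-q ⟨
        pow2 q             ≡⟨ pow2-% pow2k≡1 q ⟩
        pow2 (q % suc k)   ≡⟨ cong pow2 (n∣m⇒m%n≡0 q (suc k) k∣q) ⟩
        pow2 0             ≡⟨ pow2-0 ⟩
        1                  ∎)
        where open ≡-Reasoning
      k≡2 : suc k ≡ 2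
      k≡2 = ∣2*q∧∤q⇒≡2 q-prime (m%n≡0⇒n∣m n (suc k) n%k≡) k∤q k<n
      pow2-2≢1 : pow2 2 ≢ 1
      pow2-2≢1 eq with trans (sym (m<n⇒m%n≡m 4<p)) eq
      ... | ()

  private
    pow2-injective-≤ : ∀ {a b} → a ≤ b → b < n → pow2 a ≡ pow2 b → a ≡ b
    pow2-injective-≤ {a} {b} a≤b b<n eq = ≤-antisym a≤b (m∸n≡0⇒m≤n (n≤0⇒n≡0 (≮⇒≥ λ 0<b∸a →
      pow2-order 0<b∸a (≤-<-trans (m∸n≤m b a) b<n)
                 (pow2-cancelˡ a (b ∸ a) (trans (cong pow2 (m+[n∸m]≡n a≤b)) (sym eq))))))

  pow2-injective : ∀ {a b} → a < n → b < n → pow2 a ≡ pow2 b → a ≡ b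
  pow2-injective {a} {b} a<n b<n eq with ≤-total a b
  ... | inj₁ a≤b = pow2-injective-≤ a≤b b<n eq
  ... | inj₂ b≤a = sym (pow2-injective-≤ b≤a a<n (sym eq))

  pow2-surjective : ∀ {d} → 0 < d → d < p → ∃ λ k → k < n × pow2 k ≡ d
  pow2-surjective {d} 0<d d<p = toℕ x , Fin.toℕ<n x ,
    pred-injective {{≢-nonZero (pow2≢0 (toℕ x))}} {{>-nonZero 0<d}}
      (trans (sym (Fin.toℕ-fromℕ< (pred-pow2<n (toℕ x)))) (trans (cong toℕ Fx≡d-1) (Fin.toℕ-fromℕ< pred-d<n)))
    where
    pred-pow2<n : ∀ k → pred (pow2 k) < n
    pred-pow2<n k = pred-mono-< {{≢-nonZero (pow2≢0 k)}} (pow2<p k)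
    pred-d<n : pred d < n
    pred-d<n = pred-mono-< {{>-nonZero 0<d}} d<p
    F : Fin n → Fin n
    F i = fromℕ< (pred-pow2<n (toℕ i))
    F-injective : Injective _≡_ _≡_ F
    F-injective {i} {j} Fi≡Fj = Fin.toℕ-injective (pow2-injective (Fin.toℕ<n i) (Fin.toℕ<n j)
      (pred-injective {{≢-nonZero (pow2≢0 (toℕ i))}} {{≢-nonZero (pow2≢0 (toℕ j))}}
        (trans (sym (Fin.toℕ-fromℕ< (pred-pow2<n (toℕ i))))
               (trans (cong toℕ Fi≡Fj) (Fin.toℕ-fromℕ< (pred-pow2<n (toℕ j)))))))
    x = proj₁ (Fin-injective⇒surjective F F-injective (fromℕ< pred-d<n))
    Fx≡d-1 = proj₂ (Fin-injective⇒surjective F F-injective (fromℕ< pred-d<n))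

  tχ-spec : ∀ {d} → 0 < d → d < p → tχ p d < n × pow2 (tχ p d) ≡ d
  tχ-spec {d} 0<d d<p with pow2-surjective 0<d d<p
  ... | k , k<n , pow2k≡d =
    map₂ (λ eq → trans eq d%p≡d) (dlogFrom-finds p d 0 n z≤n k<n (trans pow2k≡d (sym d%p≡d)))
    where
    d%p≡d : d % p ≡ d
    d%p≡d = m<n⇒m%n≡m d<p

  tχ-pow2 : ∀ {k} → k < n → tχ p (pow2 k) ≡ k
  tχ-pow2 {k} k<n = pow2-injective (proj₁ spec) k<n (proj₂ spec)
    where
    spec = tχ-spec (n≢0⇒n>0 (pow2≢0 k)) (pow2<p k)

  tχ≡⇒≡pow2 : ∀ {d k} → 0 < d → d < p → tχ p d ≡ k → d ≡ pow2 k
  tχ≡⇒≡pow2 0<d d<p refl = sym (proj₂ (tχ-spec 0<d d<p))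

  tχbar-cases : ∀ e → (tχ p e ≡ 0 × tχbar p e ≡ 0) ⊎ (0 < tχ p e × tχbar p e ≡ n ∸ tχ p e)
  tχbar-cases e with tχ p e
  ... | zero  = inj₁ (refl , refl)
  ... | suc _ = inj₂ (z<s , refl)

  pow2[n∸1]≡1+q : pow2 (n ∸ 1) ≡ suc q
  pow2[n∸1]≡1+q = double-injective (pow2<p (n ∸ 1)) 1+q<p (begin
    2 * pow2 (n ∸ 1) % p   ≡⟨ pow2-suc (n ∸ 1) ⟨
    pow2 (suc (n ∸ 1))     ≡⟨ cong pow2 (m+[n∸m]≡n 0<n) ⟩
    pow2 n                 ≡⟨ pow2-n ⟩
    1                      ≡⟨ trans ([m+n]%n≡m%n 1 p) (m<n⇒m%n≡m (s≤s 0<n)) ⟨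
    (1 + p) % p            ≡⟨ cong (_% p) (2*[1+q]≡1+p q) ⟨
    2 * suc q % p          ∎)
    where
    open ≡-Reasoning
    2*[1+q]≡1+p : ∀ q → 2 * suc q ≡ 1 + suc (2 * q)
    2*[1+q]≡1+p = ℕ-Solver.solve-∀

  tχ-1 : tχ p 1 ≡ 0
  tχ-1 = subst (λ d → tχ p d ≡ 0) pow2-0 (tχ-pow2 0<n)

  tχ-2 : tχ p 2 ≡ 1
  tχ-2 = subst (λ d → tχ p d ≡ 1) pow2-1 (tχ-pow2 1<n)

  tχ-[1+q] : tχ p (suc q) ≡ n ∸ 1
  tχ-[1+q] = subst (λ d → tχ p d ≡ n ∸ 1) pow2[n∸1]≡1+q (tχ-pow2 (∸-monoʳ-< z<s 0<n))

  tχbar-1 : tχbar p 1 ≡ 0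
  tχbar-1 with tχbar-cases 1
  ... | inj₁ (_ , t̄≡0)  = t̄≡0
  ... | inj₂ (0<t , _)  = contradiction (subst (0 <_) tχ-1 0<t) (<-irrefl refl)

  tχbar-[1+q] : tχbar p (suc q) ≡ 1
  tχbar-[1+q] with tχbar-cases (suc q)
  ... | inj₁ (t≡0 , _) = contradiction (trans (sym tχ-[1+q]) t≡0) (>⇒≢ (m<n⇒0<n∸m 1<n))
  ... | inj₂ (_ , t̄≡)  = trans t̄≡ (trans (cong (n ∸_) tχ-[1+q]) (m∸[m∸n]≡n 0<n))

  tχ≡0⇒≡1 : ∀ {d} → 0 < d → d < p → tχ p d ≡ 0 → d ≡ 1
  tχ≡0⇒≡1 0<d d<p t≡0 = trans (tχ≡⇒≡pow2 0<d d<p t≡0) pow2-0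

  tχ≡1⇒≡2 : ∀ {d} → 0 < d → d < p → tχ p d ≡ 1 → d ≡ 2
  tχ≡1⇒≡2 0<d d<p t≡1 = trans (tχ≡⇒≡pow2 0<d d<p t≡1) pow2-1

  tχbar≡0⇒≡1 : ∀ {e} → 0 < e → e < p → tχbar p e ≡ 0 → e ≡ 1
  tχbar≡0⇒≡1 {e} 0<e e<p t̄≡0 with tχbar-cases e
  ... | inj₁ (t≡0 , _) = tχ≡0⇒≡1 0<e e<p t≡0
  ... | inj₂ (_ , t̄≡)  = contradiction (m∸n≡0⇒m≤n (trans (sym t̄≡) t̄≡0)) (<⇒≱ (proj₁ (tχ-spec 0<e e<p)))

  tχbar≡1⇒≡1+q : ∀ {e} → 0 < e → e < p → tχbar p e ≡ 1 → e ≡ suc q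
  tχbar≡1⇒≡1+q {e} 0<e e<p t̄≡1 with tχbar-cases e
  ... | inj₁ (_ , t̄≡0) = contradiction (trans (sym t̄≡0) t̄≡1) λ ()
  ... | inj₂ (_ , t̄≡)  = trans (tχ≡⇒≡pow2 0<e e<p t≡n∸1) pow2[n∸1]≡1+q
    where
    t≡n∸1 : tχ p e ≡ n ∸ 1
    t≡n∸1 = trans (sym (m∸[m∸n]≡n (<⇒≤ (proj₁ (tχ-spec 0<e e<p))))) (cong (n ∸_) (trans (sym t̄≡) t̄≡1))

  private
    exponent-shift : ∀ {d e} c → 0 < d × d < p → 0 < e × e < p → tχ p d + tχbar p e ≡ c + n →
                     0 < tχ p e × tχ p d ≡ c + tχ p e
    exponent-shift {d} {e} c (0<d , d<p) (0<e , e<p) sum≡ with tχbar-cases e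
    ... | inj₁ (_ , t̄≡0) =
      contradiction (≤-trans (m≤n+m n c) (≤-reflexive c+n≡td)) (<⇒≱ (proj₁ (tχ-spec 0<d d<p)))
      where
      c+n≡td : c + n ≡ tχ p d
      c+n≡td = trans (sym sum≡) (trans (cong (_+_ (tχ p d)) t̄≡0) (+-identityʳ (tχ p d)))
    ... | inj₂ (0<t , t̄≡) = 0<t , +-cancelʳ-≡ (n ∸ tχ p e) (tχ p d) (c + tχ p e) (begin
      tχ p d + (n ∸ tχ p e)          ≡⟨ cong (_+_ (tχ p d)) t̄≡ ⟨
      tχ p d + tχbar p e             ≡⟨ sum≡ ⟩
      c + n                          ≡⟨ cong (_+_ c) (m+[n∸m]≡n (<⇒≤ (proj₁ (tχ-spec 0<e e<p)))) ⟨
      c + (tχ p e + (n ∸ tχ p e))    ≡⟨ +-assoc c (tχ p e) _ ⟨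
      c + tχ p e + (n ∸ tχ p e)      ∎)
      where open ≡-Reasoning

  exponent-sum≡n : ∀ {d e} → 0 < d × d < p → 0 < e × e < p →
                   tχ p d + tχbar p e ≡ n → d ≡ e × d ≢ 1
  exponent-sum≡n {d} {e} d∈ e∈@(0<e , e<p) sum≡ =
    trans (tχ≡⇒≡pow2 (proj₁ d∈) (proj₂ d∈) td≡te) (proj₂ (tχ-spec 0<e e<p)) ,
    λ d≡1 → >⇒≢ 0<te (trans (sym td≡te) (trans (cong (tχ p) d≡1) tχ-1))
    where
    0<te = proj₁ (exponent-shift 0 d∈ e∈ sum≡)
    td≡te = proj₂ (exponent-shift 0 d∈ e∈ sum≡)

  exponent-sum≡1+n : ∀ {d e} → 0 < d × d < p → 0 < e × e < p →
                     tχ p d + tχbar p e ≡ suc n → d ≡ 2 * e % p × d ≢ 1 × e ≢ 1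
  exponent-sum≡1+n {d} {e} d∈ e∈@(0<e , e<p) sum≡ =
    trans (tχ≡⇒≡pow2 (proj₁ d∈) (proj₂ d∈) td≡1+te)
          (trans (pow2-suc (tχ p e)) (cong (λ x → 2 * x % p) (proj₂ (tχ-spec 0<e e<p)))) ,
    (λ d≡1 → 1+n≢0 (trans (sym td≡1+te) (trans (cong (tχ p) d≡1) tχ-1))) ,
    (λ e≡1 → >⇒≢ 0<te (trans (cong (tχ p) e≡1) tχ-1))
    where
    0<te = proj₁ (exponent-shift 1 d∈ e∈ sum≡)
    td≡1+te = proj₂ (exponent-shift 1 d∈ e∈ sum≡)

  divisor-range : ∀ {d j} → 0 < j → j < p → d ∣ j → 0 < d × d < p
  divisor-range 0<j j<p d∣j = ∣⇒pos 0<j d∣j , ≤-<-trans (∣⇒≤ {{>-nonZero 0<j}} d∣j) j<p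

  complement-range : ∀ {j} → 0 < j → j < p → 0 < p ∸ j × p ∸ j < p
  complement-range 0<j j<p = m<n⇒0<n∸m j<p , ∸-monoʳ-< 0<j (<⇒≤ j<p)

  complement-divisor-range : ∀ {e j} → 0 < j → j < p → e ∣ p ∸ j → 0 < e × e < p
  complement-divisor-range 0<j j<p = uncurry divisor-range (complement-range 0<j j<p)

  no-exponent-pair : ∀ {i j d e} → i ≡ n ⊎ i ≡ suc n → 0 < j → j < p → d ∣ j → e ∣ p ∸ j →
                     tχ p d + tχbar p e ≢ i
  no-exponent-pair (inj₁ refl) 0<j j<p d∣j e∣p∸j sum≡
    with exponent-sum≡n (divisor-range 0<j j<p d∣j) (complement-divisor-range 0<j j<p e∣p∸j) sum≡
  ... | refl , d≢1 =
    d≢1 (prime∧∣∧<⇒≡1 p-prime (∣∧∣∸⇒∣ (<⇒≤ j<p) d∣j e∣p∸j) (proj₂ (divisor-range 0<j j<p d∣j)))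
  no-exponent-pair (inj₂ refl) 0<j j<p d∣j e∣p∸j sum≡
    with exponent-sum≡1+n (divisor-range 0<j j<p d∣j) (complement-divisor-range 0<j j<p e∣p∸j) sum≡
  ... | d≡2e%p , d≢1 , e≢1 = [ d≢1 , e≢1 ]′
    (double-divisor p-prime 0<j j<p d∣j e∣p∸j (proj₂ (complement-divisor-range 0<j j<p e∣p∸j)) d≡2e%p)

  hχ-coeff-0 : ∀ {j} → 0 < j → j < p → h (tχ p) j 0 ≡ 1ℤ
  hχ-coeff-0 {j} 0<j j<p = h-coeff-unique (tχ p) j 0 0<j (1∣ j) tχ-1
    (λ d∣j → uncurry tχ≡0⇒≡1 (divisor-range 0<j j<p d∣j))

  hχbar-coeff-0 : ∀ {j} → 0 < j → j < p → h (tχbar p) j 0 ≡ 1ℤ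
  hχbar-coeff-0 {j} 0<j j<p = h-coeff-unique (tχbar p) j 0 0<j (1∣ j) tχbar-1
    (λ d∣j → uncurry tχbar≡0⇒≡1 (divisor-range 0<j j<p d∣j))

  hχ-coeff-1 : ∀ {j} → 0 < j → j < p → h (tχ p) j 1 ≡ ⟦ 2 ∣? j ⟧
  hχ-coeff-1 {j} 0<j j<p = h-coeff-indicator (tχ p) j 1 2 0<j tχ-2
    (λ d∣j → uncurry tχ≡1⇒≡2 (divisor-range 0<j j<p d∣j))

  hχbar-coeff-1 : ∀ {j} → 0 < j → j < p → h (tχbar p) j 1 ≡ ⟦ suc q ∣? j ⟧
  hχbar-coeff-1 {j} 0<j j<p = h-coeff-indicator (tχbar p) j 1 (suc q) 0<j tχbar-[1+q]
    (λ d∣j → uncurry tχbar≡1⇒≡1+q (divisor-range 0<j j<p d∣j))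

  1+q∣p∸j⇔j≡q : ∀ {j} → 0 < j → j < p → (suc q ∣ p ∸ j → j ≡ q) × (j ≡ q → suc q ∣ p ∸ j)
  1+q∣p∸j⇔j≡q {j} 0<j j<p =
    (λ 1+q∣p∸j → begin
      j                  ≡⟨ m∸[m∸n]≡n (<⇒≤ j<p) ⟨
      p ∸ (p ∸ j)        ≡⟨ cong (p ∸_) (∣∧<2*⇒≡ 1+q∣p∸j (proj₁ (complement-range 0<j j<p)) p∸j<2+2q) ⟩
      p ∸ suc q          ≡⟨ p∸[1+q]≡q ⟩
      q                  ∎) ,
    (λ { refl → ∣-reflexive (sym p∸q≡1+q) })
    where
    open ≡-Reasoning
    p≡[1+q]+q : ∀ q → suc (2 * q) ≡ suc q + q
    p≡[1+q]+q = ℕ-Solver.solve-∀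
    p≡q+[1+q] : ∀ q → suc (2 * q) ≡ q + suc q
    p≡q+[1+q] = ℕ-Solver.solve-∀
    p∸[1+q]≡q : p ∸ suc q ≡ q
    p∸[1+q]≡q = trans (cong (_∸ suc q) (p≡[1+q]+q q)) (m+n∸m≡n (suc q) q)
    p∸q≡1+q : p ∸ q ≡ suc q
    p∸q≡1+q = trans (cong (_∸ q) (p≡q+[1+q] q)) (m+n∸m≡n q (suc q))
    p∸j<2+2q : p ∸ j < 2 * suc q
    p∸j<2+2q = <-trans (proj₂ (complement-range 0<j j<p)) (subst (p <_) (sym (*-distribˡ-+ 2 1 q)) (n<1+n p))

  fχ-term : ℕ → Poly
  fχ-term j = h (tχ p) j ⊛ h (tχbar p) (p ∸ j)

  fχ-term-0 : ∀ {j} → 0 < j → j < p → fχ-term j 0 ≡ 1ℤ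
  fχ-term-0 0<j j<p =
    cong₂ (λ a b → 0ℤ ℤ.+ a ℤ.* b) (hχ-coeff-0 0<j j<p) (uncurry hχbar-coeff-0 (complement-range 0<j j<p))

  fχ-term-1 : ∀ {j} → 0 < j → j < p → fχ-term j 1 ≡ ⟦ j ≟ q ⟧ ℤ.+ ⟦ 2 ∣? j ⟧
  fχ-term-1 {j} 0<j j<p = begin
    0ℤ ℤ.+ h (tχ p) j 0 ℤ.* h (tχbar p) (p ∸ j) 1 ℤ.+ h (tχ p) j 1 ℤ.* h (tχbar p) (p ∸ j) 0
      ≡⟨ cong₂ (λ a b → 0ℤ ℤ.+ a ℤ.* h (tχbar p) (p ∸ j) 1 ℤ.+ h (tχ p) j 1 ℤ.* b)
               (hχ-coeff-0 0<j j<p) (uncurry hχbar-coeff-0 (complement-range 0<j j<p)) ⟩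
    0ℤ ℤ.+ 1ℤ ℤ.* h (tχbar p) (p ∸ j) 1 ℤ.+ h (tχ p) j 1 ℤ.* 1ℤ
      ≡⟨ cong₂ (λ a b → 0ℤ ℤ.+ 1ℤ ℤ.* a ℤ.+ b ℤ.* 1ℤ)
               (uncurry hχbar-coeff-1 (complement-range 0<j j<p)) (hχ-coeff-1 0<j j<p) ⟩
    0ℤ ℤ.+ 1ℤ ℤ.* ⟦ suc q ∣? p ∸ j ⟧ ℤ.+ ⟦ 2 ∣? j ⟧ ℤ.* 1ℤ
      ≡⟨ cong₂ ℤ._+_ (trans (ℤP.+-identityˡ (1ℤ ℤ.* ⟦ suc q ∣? p ∸ j ⟧)) (ℤP.*-identityˡ ⟦ suc q ∣? p ∸ j ⟧))
                     (ℤP.*-identityʳ ⟦ 2 ∣? j ⟧) ⟩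
    ⟦ suc q ∣? p ∸ j ⟧ ℤ.+ ⟦ 2 ∣? j ⟧
      ≡⟨ cong (ℤ._+ ⟦ 2 ∣? j ⟧) (uncurry ⟦⟧-cong (1+q∣p∸j⇔j≡q 0<j j<p) (suc q ∣? p ∸ j) (j ≟ q)) ⟩
    ⟦ j ≟ q ⟧ ℤ.+ ⟦ 2 ∣? j ⟧ ∎
    where open ≡-Reasoning

  fχ-term-vanishes : ∀ {i j} → i ≡ n ⊎ i ≡ suc n → 0 < j → j < p → fχ-term j i ≡ 0ℤ
  fχ-term-vanishes {i} {j} i≡ 0<j j<p =
    h⊛h-coeff-none (tχ p) (tχbar p) j (p ∸ j) i (no-exponent-pair i≡ 0<j j<p)

  fχ-0 : fχ p 0 ≡ + n
  fχ-0 = begin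
    fχ p 0                        ≡⟨ sumPoly-coeff n fχ-term 0 ⟩
    sum₁ n (λ j → fχ-term j 0)    ≡⟨ sum₁-cong n (λ 0<j j≤n → fχ-term-0 0<j (s≤s j≤n)) ⟩
    sum₁ n (λ _ → 1ℤ)             ≡⟨ sum₁-ones n ⟩
    + n                           ∎
    where open ≡-Reasoning

  fχ-1 : fχ p 1 ≡ + suc q
  fχ-1 = begin
    fχ p 1                                  ≡⟨ sumPoly-coeff n fχ-term 1 ⟩
    sum₁ n (λ j → fχ-term j 1)              ≡⟨ sum₁-cong n (λ 0<j j≤n → fχ-term-1 0<j (s≤s j≤n)) ⟩
    sum₁ n (λ j → ⟦ j ≟ q ⟧ ℤ.+ ⟦ 2 ∣? j ⟧) ≡⟨ sum₁-+ n _ _ ⟩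
    sum₁ n (λ j → ⟦ j ≟ q ⟧) ℤ.+ sum₁ n (λ j → ⟦ 2 ∣? j ⟧)
      ≡⟨ cong₂ ℤ._+_ (sum₁-≟ (>-nonZero⁻¹ q) (m≤m+n q (q + 0))) (sum₁-even q) ⟩
    1ℤ ℤ.+ + q                              ≡⟨ ℤP.pos-+ 1 q ⟨
    + suc q                                 ∎
    where open ≡-Reasoning

  fχ-vanishes : ∀ {i} → i ≡ n ⊎ i ≡ suc n → fχ p i ≡ 0ℤ
  fχ-vanishes {i} i≡ = begin
    fχ p i                        ≡⟨ sumPoly-coeff n fχ-term i ⟩
    sum₁ n (λ j → fχ-term j i)    ≡⟨ sum₁-cong n (λ 0<j j≤n → fχ-term-vanishes i≡ 0<j (s≤s j≤n)) ⟩
    sum₁ n (λ _ → 0ℤ)             ≡⟨ sum₁-zero n ⟩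
    0ℤ                            ∎
    where open ≡-Reasoning

proposition8 : (q p : ℕ) → Prime q → q % 4 ≡ 1 → p ≡ 2 * q + 1 → Prime p →
    ((i : ℕ) → i ≤ 2 * p ∸ 4 → ℤ.0ℤ ℤ.≤ fχ p i)
    × fχ p 0 ≡ + (p ∸ 1)
    × fχ p 1 ≡ + ((p ∸ 1) / 2 + 1)
    × fχ p p ≡ + 0
    × fχ p (p ∸ 1) ≡ + 0
proposition8 q p q-prime q%4≡1 p≡2q+1 p-prime with refl ← trans p≡2q+1 (+-comm (2 * q) 1) =
  (λ i _ → natural⇒nonNegative (fχ-natural p i)) ,
  fχ-0 ,
  trans fχ-1 (cong +_ (sym [p∸1]/2+1≡1+q)) ,
  fχ-vanishes (inj₂ refl) ,
  fχ-vanishes (inj₁ refl)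
  where
  q≡4r+1 : q ≡ 2 * (2 * (q / 4)) + 1
  q≡4r+1 = trans (m≡m%n+[m/n]*n q 4) (trans (cong (_+ q / 4 * 4) q%4≡1) (1+4r≡ (q / 4)))
    where
    1+4r≡ : ∀ r → 1 + r * 4 ≡ 2 * (2 * r) + 1
    1+4r≡ = ℕ-Solver.solve-∀
  open SafePrime q-prime p-prime (2q+1∣2^q+1 {q / 4} q≡4r+1 p-prime) using (fχ-0; fχ-1; fχ-vanishes)
  [p∸1]/2+1≡1+q : 2 * q / 2 + 1 ≡ suc q
  [p∸1]/2+1≡1+q = trans (cong (λ x → x / 2 + 1) (*-comm 2 q)) (trans (cong (_+ 1) (m*n/n≡m q 2)) (+-comm q 1))
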